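{- Let $\mathbb{A}$ be a non-empty set, $C$ a finite non-empty set, $\varphi:\mathbb{A}^+\to C$ a map, $x\in\mathbb{A}^\omega$ and $k\ge1$ an integer. Then there exists a suffix $x'$ of $x$ which admits a $k$-shift invariant $\varphi$-sequentially monochromatic factorization.
   Context: $\mathbb{A}^+$ is the set of non-empty finite words over $\mathbb{A}$, $\mathbb{A}^\omega$ the right-infinite words; a suffix of $x=x_0x_1\cdots$ is $x_nx_{n+1}\cdots$ for some $n\ge0$. $T$ is the shift, $T(x_0x_1x_2\cdots)=x_1x_2\cdots$. A factorization $z=V_0V_1V_2\cdots$ ($V_i\in\mathbb{A}^+$) is $\varphi$-sequentially monochromatic if there is $c\in C$ with $\varphi(V_iV_{i+1}\cdots V_{i+j})=c$ for all $i,j\ge0$. A $\varphi$-sequentially monochromatic factorization $z=V_0V_1V_2\cdots$ is $k$-shift invariant if for each $1\le j\le k$ the induced factorization $T^j(z)=W_0W_1W_2\cdots$ with $|W_i|=|V_i|$ for all $i$ is also $\varphi$-sequentially monochromatic (with a color possibly depending on $j$). -}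

module Defs where

open import Level using (Level)
open import Data.Nat using (ℕ; zero; suc; _+_)
open import Data.List using (List; []; _∷_)
open import Data.List.NonEmpty using (List⁺; _∷_)
open import Data.Product using (Σ; ∃; _×_)
open import Relation.Binary.PropositionalEquality using (_≡_)

Word∞ : ∀ {a} → Set a → Set a
Word∞ A = ℕ → A

shift : ∀ {a} {A : Set a} → ℕ → Word∞ A → Word∞ A
shift n x i = x (n + i)

IsSuffix : ∀ {a} {A : Set a} → Word∞ A → Word∞ A → Set a
IsSuffix {A = A} x' x = ∃ λ (n : ℕ) → ∀ i → x' i ≡ x (n + i)

-- the non-empty finite word z_p z_{p+1} ... z_{p+m} (length m+1)
block : ∀ {a} {A : Set a} → Word∞ A → ℕ → ℕ → List⁺ A
block z p m = z p ∷ rest p m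
  where
  rest : ℕ → ℕ → List _
  rest q zero    = []
  rest q (suc m) = z (suc q) ∷ rest (suc q) m

-- A factorization z = V_0 V_1 V_2 ... into non-empty words is given by
-- the sequence of lengths |V_i| = suc (len i).  Cut positions:
-- cut len i = |V_0 ... V_{i-1}|.
cut : (ℕ → ℕ) → ℕ → ℕ
cut len zero    = zero
cut len (suc i) = suc (len i) + cut len i

-- |V_i V_{i+1} ... V_{i+j}| = suc (span len i j)
span : (ℕ → ℕ) → ℕ → ℕ → ℕ
span len i zero    = len i
span len i (suc j) = suc (len (i + suc j)) + span len i j

factorWord : ∀ {a} {A : Set a} → Word∞ A → (ℕ → ℕ) → ℕ → ℕ → List⁺ A
factorWord z len i j = block z (cut len i) (span len i j)

SeqMono : {A C : Set} → (List⁺ A → C) →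
          Word∞ A → (ℕ → ℕ) → Set
SeqMono {C = C} φ z len =
  Σ C λ col → ∀ i j → φ (factorWord z len i j) ≡ col

KShiftInvSeqMono : {A C : Set} → (List⁺ A → C) →
                   ℕ → Word∞ A → (ℕ → ℕ) → Set
KShiftInvSeqMono φ k z len =
  ∀ j → j Data.Nat.≤ k → SeqMono φ (shift j z) len

-- The proof is the classical one via the infinite Ramsey theorem for pairs.
-- For an offset t, colour a pair of positions p < q by the φ-colour of the
-- finite word x_{t+p} ... x_{t+q-1}.  Applying Ramsey's theorem k+1 times,
-- each time inside the previously obtained infinite set, yields a strictly
-- increasing sequence g 0 < g 1 < ... that is homogeneous for the colourings
-- of all offsets t = 0 … k simultaneously.  Cutting the suffix x_{g 0} x_{g 0 + 1} ...
-- at the positions g i gives a factorization whose blocks V_i ... V_{i+j},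
-- read in T^t of the suffix, are exactly the words between g i and
-- g (i+j+1) at offset t; homogeneity makes them all share one colour.
module Submission where

open import Defs
open import Level using (0ℓ)
open import Axiom.ExcludedMiddle using (ExcludedMiddle)
open import Data.Nat using (ℕ; zero; suc; _+_; _∸_; _⊔_; _≤_; _<_; _≥_; s≤s)
open import Data.Nat.Properties
open import Algebra.Properties.CommutativeSemigroup +-commutativeSemigroup using (x∙yz≈y∙xz)
open import Data.Fin using (Fin; toℕ)
open import Data.Fin.Properties using (toℕ<n; toℕ-injective)
open import Data.List.NonEmpty using (List⁺; _∷⁺_; [_])
open import Data.Product using (Σ; ∃; _×_; _,_; proj₁; proj₂)
open import Data.Sum using (inj₁; inj₂)
open import Data.Unit using (⊤; tt)
open import Data.Empty using (⊥-elim)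
open import Function using (_∘_; id)
open import Relation.Nullary using (¬_; yes; no)
open import Relation.Binary.PropositionalEquality
  using (_≡_; refl; sym; trans; cong; cong₂; subst; module ≡-Reasoning)

Infinite : (ℕ → Set) → Set
Infinite P = ∀ n → ∃ λ m → n ≤ m × P m

infinite-mono : {P Q : ℕ → Set} → (∀ i → P i → Q i) → Infinite P → Infinite Q
infinite-mono P⇒Q inf n with inf n
... | m , n≤m , p = m , n≤m , P⇒Q m p

infinite-beyond : {P : ℕ → Set} (N : ℕ) → Infinite P → Infinite (λ i → P i × N ≤ i)
infinite-beyond N inf n with inf (n ⊔ N)
... | m , n⊔N≤m , p = m , ≤-trans (m≤m⊔n n N) n⊔N≤m , p , ≤-trans (m≤n⊔m n N) n⊔N≤m

-- Strictly increasing sequences of natural numbers, i.e. infinite subsets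
-- of ℕ listed in order; subsequences are compositions g ∘ h.
StrictlyIncreasing : (ℕ → ℕ) → Set
StrictlyIncreasing g = ∀ i → g i < g (suc i)

increasing⇒monotone : {g : ℕ → ℕ} → StrictlyIncreasing g → ∀ {r s} → r < s → g r < g s
increasing⇒monotone {g} inc {r} {suc s} r<1+s with m<1+n⇒m<n∨m≡n r<1+s
... | inj₁ r<s  = <-trans (increasing⇒monotone inc r<s) (inc s)
... | inj₂ refl = inc s

increasing-∘ : {g h : ℕ → ℕ} → StrictlyIncreasing g → StrictlyIncreasing h →
               StrictlyIncreasing (g ∘ h)
increasing-∘ incg inch i = increasing⇒monotone incg (inch i)

enumerate : {P : ℕ → Set} → Infinite P →
            Σ (ℕ → ℕ) λ g → StrictlyIncreasing g × (∀ i → P (g i))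
enumerate {P} inf = g , (λ i → proj₁ (proj₂ (inf (suc (g i))))) , member
  where
  g : ℕ → ℕ
  g zero    = proj₁ (inf 0)
  g (suc i) = proj₁ (inf (suc (g i)))

  member : ∀ i → P (g i)
  member zero    = proj₂ (proj₂ (inf 0))
  member (suc i) = proj₂ (proj₂ (inf (suc (g i))))

Homogeneous : (ℕ → ℕ → ℕ) → (ℕ → ℕ) → Set
Homogeneous c g = ∃ λ d → ∀ {r s} → r < s → c (g r) (g s) ≡ d

homogeneous-∘ : {c : ℕ → ℕ → ℕ} {g h : ℕ → ℕ} →
                Homogeneous c g → StrictlyIncreasing h → Homogeneous c (g ∘ h)
homogeneous-∘ (d , hom) inch = d , λ r<s → hom (increasing⇒monotone inch r<s)

module Classical (lem : ExcludedMiddle 0ℓ) where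

  eventually-false : (P : ℕ → Set) → ¬ Infinite P → ∃ λ N → ∀ m → N ≤ m → ¬ P m
  eventually-false P finite with lem {∃ λ N → ∀ m → N ≤ m → ¬ P m}
  ... | yes bounded = bounded
  ... | no unbounded = ⊥-elim (finite witness)
    where
    witness : Infinite P
    witness n with lem {∃ λ m → n ≤ m × P m}
    ... | yes found = found
    ... | no none   = ⊥-elim (unbounded (n , λ m n≤m p → none (m , n≤m , p)))

  -- If the top colour b-1 is used only
  -- finitely often, drop the finitely many elements where it occurs.
  pigeonhole : (b : ℕ) (P : ℕ → Set) → Infinite P → (f : ℕ → ℕ) → (∀ i → P i → f i < b) →
               ∃ λ d → Infinite (λ i → P i × f i ≡ d)
  pigeonhole zero P inf f f<0 with inf 0
  ... | m , _ , p = ⊥-elim (n≮0 (f<0 m p))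
  pigeonhole (suc b) P inf f f<1+b with lem {Infinite (λ i → P i × f i ≡ b)}
  ... | yes topInfinite = b , topInfinite
  ... | no topFinite with eventually-false _ topFinite
  ...   | N , noTopBeyond with pigeonhole b (λ i → P i × N ≤ i) (infinite-beyond N inf) f f<b
    where
    f<b : ∀ i → P i × N ≤ i → f i < b
    f<b i (p , N≤i) = ≤∧≢⇒< (≤-pred (f<1+b i p)) (λ fi≡b → noTopBeyond i N≤i (p , fi≡b))
  ...     | d , inf' = d , infinite-mono (λ i ((p , _) , fi≡d) → p , fi≡d) inf'

  -- One builds a chain
  -- of nested infinite sets S₀ ⊇ S₁ ⊇ ...: S_{n+1} consists of the elements
  -- of S_n beyond a chosen element aₙ ∈ Sₙ that share one colour colourₙ
  -- with it.  Then c (a r) (a s) = colour r for r < s, and a second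
  -- pigeonhole on the colours colourₙ gives the homogeneous subsequence.
  module _ {b : ℕ} (c : ℕ → ℕ → ℕ) (c<b : ∀ i j → c i j < b) where

    record InfiniteSet : Set₁ where
      field
        member   : ℕ → Set
        infinite : Infinite member
    open InfiniteSet

    pick : InfiniteSet → ℕ
    pick S = proj₁ (infinite S 0)

    pick∈ : (S : InfiniteSet) → member S (pick S)
    pick∈ S = proj₂ (proj₂ (infinite S 0))

    Beyond : InfiniteSet → ℕ → Set
    Beyond S j = member S j × pick S < j

    colourClass : (S : InfiniteSet) →
                  ∃ λ d → Infinite (λ j → Beyond S j × c (pick S) j ≡ d)
    colourClass S = pigeonhole b (Beyond S) (infinite-beyond (suc (pick S)) (infinite S))
                               (c (pick S)) (λ j _ → c<b (pick S) j)

    refine : InfiniteSet → InfiniteSet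
    refine S = record { member   = λ j → Beyond S j × c (pick S) j ≡ proj₁ (colourClass S)
                      ; infinite = proj₂ (colourClass S) }

    chain : ℕ → InfiniteSet
    chain zero    = record { member = λ _ → ⊤ ; infinite = λ n → n , ≤-refl , tt }
    chain (suc n) = refine (chain n)

    head : ℕ → ℕ
    head n = pick (chain n)

    colour : ℕ → ℕ
    colour n = proj₁ (colourClass (chain n))

    chain-antitone : ∀ {r s} → r ≤ s → ∀ j → member (chain s) j → member (chain r) j
    chain-antitone {r} {s} r≤s j j∈ with m≤n⇒m<n∨m≡n r≤s
    chain-antitone {r} {suc s} _ j ((j∈ , _) , _) | inj₁ (s≤s r≤s) = chain-antitone r≤s j j∈
    ... | inj₂ refl = j∈

    -- Every later head lies in the refinement of an earlier chain set.
    head-later : ∀ {r s} → r < s → head r < head s × c (head r) (head s) ≡ colour r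
    head-later {r} {s} r<s with chain-antitone r<s (head s) (pick∈ (chain s))
    ... | (_ , hr<hs) , colour≡ = hr<hs , colour≡

    colour<b : ∀ n → colour n < b
    colour<b n with proj₂ (colourClass (chain n)) 0
    ... | j , _ , _ , c≡colour = subst (_< b) c≡colour (c<b (head n) j)

    ramsey : Σ (ℕ → ℕ) λ g → StrictlyIncreasing g × Homogeneous c g
    ramsey with pigeonhole b (λ _ → ⊤) (λ n → n , ≤-refl , tt) colour (λ n _ → colour<b n)
    ... | d , sameColour with enumerate sameColour
    ...   | h , inch , h∈ =
      head ∘ h , (λ i → proj₁ (head-later (inch i))) , d ,
      λ {r} r<s → trans (proj₂ (head-later (increasing⇒monotone inch r<s))) (proj₂ (h∈ r))

  -- Ramsey's theorem for finitely many colourings c 0, …, c (n-1) at once: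
  -- apply it to each colouring in turn inside the previous subsequence.
  ramseyFamily : {b : ℕ} (c : ℕ → ℕ → ℕ → ℕ) → (∀ t i j → c t i j < b) → (n : ℕ) →
                 Σ (ℕ → ℕ) λ g → StrictlyIncreasing g × (∀ t → t < n → Homogeneous (c t) g)
  ramseyFamily c c<b zero = id , (λ i → ≤-refl) , λ t ()
  ramseyFamily c c<b (suc n) with ramseyFamily c c<b n
  ... | g , incg , homs with ramsey (λ i j → c n (g i) (g j)) (λ i j → c<b n (g i) (g j))
  ...   | h , inch , homN = g ∘ h , increasing-∘ incg inch , homs'
    where
    homs' : ∀ t → t < suc n → Homogeneous (c t) (g ∘ h)
    homs' t t<1+n with m<1+n⇒m<n∨m≡n t<1+n
    ... | inj₁ t<n  = homogeneous-∘ {c = c t} {g = g} (homs t t<n) inch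
    ... | inj₂ refl = homN

first-letter : {A : Set} (z z' : Word∞ A) (p p' : ℕ) → (∀ q → z (p + q) ≡ z' (p' + q)) →
               z p ≡ z' p'
first-letter z z' p p' same =
  trans (cong z (sym (+-identityʳ p))) (trans (same 0) (cong z' (+-identityʳ p')))

block-ext : {A : Set} (z z' : Word∞ A) (p p' m : ℕ) → (∀ q → z (p + q) ≡ z' (p' + q)) →
            block z p m ≡ block z' p' m
block-ext z z' p p' zero    same = cong [_] (first-letter z z' p p' same)
block-ext z z' p p' (suc m) same =
  cong₂ _∷⁺_ (first-letter z z' p p' same)
             (block-ext z z' (suc p) (suc p') m λ q →
               trans (cong z (sym (+-suc p q))) (trans (same (suc q)) (cong z' (+-suc p' q))))

cut-span : (len : ℕ → ℕ) (i j : ℕ) → cut len i + suc (span len i j) ≡ cut len (suc (i + j))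
cut-span len i zero = begin
  cut len i + suc (len i)  ≡⟨ +-comm (cut len i) (suc (len i)) ⟩
  suc (len i) + cut len i  ≡⟨ cong (λ n → cut len (suc n)) (sym (+-identityʳ i)) ⟩
  cut len (suc (i + 0))    ∎
  where open ≡-Reasoning
cut-span len i (suc j) = begin
  cut len i + suc (suc L + S)    ≡⟨ cong (cut len i +_) (sym (+-suc (suc L) S)) ⟩
  cut len i + (suc L + suc S)    ≡⟨ x∙yz≈y∙xz (cut len i) (suc L) (suc S) ⟩
  suc L + (cut len i + suc S)    ≡⟨ cong (suc L +_) (cut-span len i j) ⟩
  suc L + cut len (suc (i + j))  ≡⟨ cong (λ n → suc L + cut len n) (sym (+-suc i j)) ⟩
  cut len (suc (i + suc j))      ∎
  where
  open ≡-Reasoning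
  L = len (i + suc j)
  S = span len i j

-- The block lengths of the factorization of x_{g 0} x_{g 0 + 1} ... that
-- cuts at the positions g 0 < g 1 < g 2 < ...
gaps : (ℕ → ℕ) → ℕ → ℕ
gaps g i = g (suc i) ∸ suc (g i)

module _ {g : ℕ → ℕ} (inc : StrictlyIncreasing g) where
  open ≡-Reasoning

  cut-gaps : ∀ i → cut (gaps g) i + g 0 ≡ g i
  cut-gaps zero    = refl
  cut-gaps (suc i) = begin
    suc (gaps g i) + cut (gaps g) i + g 0    ≡⟨ +-assoc (suc (gaps g i)) (cut (gaps g) i) (g 0) ⟩
    suc (gaps g i) + (cut (gaps g) i + g 0)  ≡⟨ cong (suc (gaps g i) +_) (cut-gaps i) ⟩
    suc (gaps g i) + g i                     ≡⟨ sym (+-suc (gaps g i) (g i)) ⟩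
    gaps g i + suc (g i)                     ≡⟨ m∸n+n≡m (inc i) ⟩
    g (suc i)                                ∎

  span-gaps : ∀ i j → span (gaps g) i j ≡ g (suc (i + j)) ∸ suc (g i)
  span-gaps i j = begin
    S                            ≡⟨ sym (m+n∸n≡m S (suc (g i))) ⟩
    S + suc (g i) ∸ suc (g i)    ≡⟨ cong (_∸ suc (g i)) ends ⟩
    g (suc (i + j)) ∸ suc (g i)  ∎
    where
    S = span (gaps g) i j
    ends : S + suc (g i) ≡ g (suc (i + j))
    ends = begin
      S + suc (g i)                         ≡⟨ +-suc S (g i) ⟩
      suc S + g i                           ≡⟨ cong (suc S +_) (sym (cut-gaps i)) ⟩
      suc S + (cut (gaps g) i + g 0)        ≡⟨ sym (+-assoc (suc S) (cut (gaps g) i) (g 0)) ⟩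
      suc S + cut (gaps g) i + g 0          ≡⟨ cong (_+ g 0) (+-comm (suc S) (cut (gaps g) i)) ⟩
      cut (gaps g) i + suc S + g 0          ≡⟨ cong (_+ g 0) (cut-span (gaps g) i j) ⟩
      cut (gaps g) (suc (i + j)) + g 0      ≡⟨ cut-gaps (suc (i + j)) ⟩
      g (suc (i + j))                       ∎

  factorWord-gaps : {A : Set} (x : Word∞ A) (t i j : ℕ) →
    factorWord (shift t (shift (g 0) x)) (gaps g) i j ≡
    block (shift t x) (g i) (g (suc (i + j)) ∸ suc (g i))
  factorWord-gaps x t i j = begin
    block (shift t (shift (g 0) x)) (cut (gaps g) i) (span (gaps g) i j)
      ≡⟨ block-ext _ _ (cut (gaps g) i) (g i) (span (gaps g) i j) (cong x ∘ same) ⟩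
    block (shift t x) (g i) (span (gaps g) i j)
      ≡⟨ cong (block (shift t x) (g i)) (span-gaps i j) ⟩
    block (shift t x) (g i) (g (suc (i + j)) ∸ suc (g i))
      ∎
    where
    same : ∀ q → g 0 + (t + (cut (gaps g) i + q)) ≡ t + (g i + q)
    same q = begin
      g 0 + (t + (cut (gaps g) i + q))  ≡⟨ x∙yz≈y∙xz (g 0) t (cut (gaps g) i + q) ⟩
      t + (g 0 + (cut (gaps g) i + q))  ≡⟨ cong (t +_) (sym (+-assoc (g 0) (cut (gaps g) i) q)) ⟩
      t + (g 0 + cut (gaps g) i + q)    ≡⟨ cong (λ n → t + (n + q)) (+-comm (g 0) (cut (gaps g) i)) ⟩
      t + (cut (gaps g) i + g 0 + q)    ≡⟨ cong (λ n → t + (n + q)) (cut-gaps i) ⟩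
      t + (g i + q)                     ∎

offsetColouring : {A : Set} {n : ℕ} → (List⁺ A → Fin n) → Word∞ A → ℕ → ℕ → ℕ → ℕ
offsetColouring φ x t p q = toℕ (φ (block (shift t x) p (q ∸ suc p)))

-- Take g homogeneous for the offset colourings of all t ≤ k; the suffix of x
-- at g 0, cut at the positions g i, is the required factorization: the
-- colour of V_i … V_{i+j} in T^t of it is that of the pair g i < g (i+j+1).
corollary3p2 : ExcludedMiddle 0ℓ →
    (A : Set) → A → (m : ℕ) → (φ : List⁺ A → Fin (suc m)) →
    (x : Word∞ A) → (k : ℕ) → k ≥ 1 →
    Σ (Word∞ A) λ x' → IsSuffix x' x ×
    Σ (ℕ → ℕ) λ len → KShiftInvSeqMono φ k x' len
corollary3p2 lem A _ m φ x k _ = shift (g 0) x , (g 0 , λ _ → refl) , gaps g , invariant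
  where
  family : Σ (ℕ → ℕ) λ g → StrictlyIncreasing g ×
             (∀ t → t < suc k → Homogeneous (offsetColouring φ x t) g)
  family = Classical.ramseyFamily lem (offsetColouring φ x) (λ _ _ _ → toℕ<n _) (suc k)

  g : ℕ → ℕ
  g = proj₁ family

  invariant : KShiftInvSeqMono φ k (shift (g 0) x) (gaps g)
  invariant t t≤k = φ (V 0 0) , λ i j → toℕ-injective (trans (colour≡d i j) (sym (colour≡d 0 0)))
    where
    V : ℕ → ℕ → List⁺ A
    V = factorWord (shift t (shift (g 0) x)) (gaps g)

    hom : Homogeneous (offsetColouring φ x t) g
    hom = proj₂ (proj₂ family) t (s≤s t≤k)

    colour≡d : ∀ i j → toℕ (φ (V i j)) ≡ proj₁ hom
    colour≡d i j = trans (cong (toℕ ∘ φ) (factorWord-gaps (proj₁ (proj₂ family)) x t i j))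
                         (proj₂ hom (s≤s (m≤m+n i j)))
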